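{- Let $L$ be a finite atomic lattice. Suppose $x,y\in L$ both cover $x\wedge y$, but $x\vee y$ does not cover $x$. If $a_y$ is an atom of $L$ with $y=(x\wedge y)\vee a_y$, then $a_y\notin A(z)$ for every $z\in L$ with $x\lessdot z$.
   Context: A lattice is atomic if every element is a join of atoms (elements covering the minimum $\hat 0$). For $w\in L$, $A(w)$ denotes the set of atoms $a$ of $L$ with $a\le w$. The notation $x\lessdot z$ means $z$ covers $x$. -}

module Defs where

open import Level using (Level; _⊔_)
open import Data.Nat using (ℕ)
open import Data.Fin using (Fin)
open import Data.Product using (Σ; ∃; _×_; _,_)
open import Data.List using (List; foldr)
open import Data.List.Relation.Unary.All using (All)
open import Relation.Nullary using (¬_)
open import Relation.Binary.Lattice.Bundles using (Lattice)

module _ {c ℓ₁ ℓ₂ : Level} (L : Lattice c ℓ₁ ℓ₂) where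
  open Lattice L

  _<L_ : Carrier → Carrier → Set (ℓ₁ ⊔ ℓ₂)
  x <L z = x ≤ z × ¬ (x ≈ z)

  _⋖_ : Carrier → Carrier → Set (c ⊔ ℓ₁ ⊔ ℓ₂)
  x ⋖ z = x <L z × (∀ w → x <L w → ¬ (w <L z))

  IsMinimum : Carrier → Set (c ⊔ ℓ₂)
  IsMinimum b = ∀ w → b ≤ w

  Finite : Set (c ⊔ ℓ₁)
  Finite = Σ ℕ λ n → Σ (Fin n → Carrier) λ f → ∀ w → ∃ λ i → f i ≈ w

  module _ (bot : Carrier) where
    IsAtom : Carrier → Set (c ⊔ ℓ₁ ⊔ ℓ₂)
    IsAtom a = bot ⋖ a

    ⋁ : List Carrier → Carrier
    ⋁ = foldr _∨_ bot

    Atomic : Set (c ⊔ ℓ₁ ⊔ ℓ₂)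
    Atomic = ∀ w → Σ (List Carrier) λ as → All IsAtom as × w ≈ ⋁ as

    _∈A_ : Carrier → Carrier → Set (c ⊔ ℓ₁ ⊔ ℓ₂)
    a ∈A w = IsAtom a × a ≤ w

module Submission where

open import Defs
open import Level using (Level)
open import Relation.Nullary using (¬_)
open import Relation.Binary.Lattice.Bundles using (Lattice)
open import Data.Product using (_,_)

-- Only a_y ≤ z and the covering x ∧ y ⋖ y matter; the statement holds in every
-- lattice. From y = (x ∧ y) ∨ a_y ≤ z we get x < x ∨ y ≤ z, so x ∨ y = z because
-- z covers x; but then x ∨ y covers x, contrary to the hypothesis.

module _ {c ℓ₁ ℓ₂ : Level} (L : Lattice c ℓ₁ ℓ₂) where
  open Lattice L

  <L-respʳ-≈ : ∀ {x z w} → _<L_ L x z → z ≈ w → _<L_ L x w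
  <L-respʳ-≈ (x≤z , x≉z) z≈w =
    trans x≤z (reflexive z≈w) , λ x≈w → x≉z (Eq.trans x≈w (Eq.sym z≈w))

  ⋖-respʳ-≈ : ∀ {x z w} → _⋖_ L x z → z ≈ w → _⋖_ L x w
  ⋖-respʳ-≈ (x<z , nothing-between) z≈w =
    <L-respʳ-≈ x<z z≈w ,
    λ v x<v v<w → nothing-between v x<v (<L-respʳ-≈ v<w (Eq.sym z≈w))

  ⋖-below-cover : ∀ {x z w} → _⋖_ L x z → _<L_ L x w → w ≤ z → ¬ ¬ (_⋖_ L x w)
  ⋖-below-cover x⋖z@(_ , nothing-between) x<w w≤z ¬x⋖w =
    nothing-between _ x<w (w≤z , λ w≈z → ¬x⋖w (⋖-respʳ-≈ x⋖z (Eq.sym w≈z)))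

  <L-∨ʳ : ∀ {x y} → _<L_ L (x ∧ y) y → _<L_ L x (x ∨ y)
  <L-∨ʳ {x} {y} (_ , x∧y≉y) =
    x≤x∨y x y ,
    λ x≈x∨y → x∧y≉y (antisym (x∧y≤y x y)
      (∧-greatest (trans (y≤x∨y x y) (reflexive (Eq.sym x≈x∨y))) refl))

  ∨-least-via-meet : ∀ {x y a z} → y ≈ (x ∧ y) ∨ a → x ≤ z → a ≤ z → x ∨ y ≤ z
  ∨-least-via-meet {x} {y} y≈x∧y∨a x≤z a≤z =
    ∨-least x≤z (trans (reflexive y≈x∧y∨a) (∨-least (trans (x∧y≤x x y) x≤z) a≤z))

lemma3 : {c ℓ₁ ℓ₂ : Level} (L : Lattice c ℓ₁ ℓ₂) → Finite L →
    (bot : Lattice.Carrier L) → IsMinimum L bot → Atomic L bot →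
    (x y : Lattice.Carrier L) →
    _⋖_ L (Lattice._∧_ L x y) x → _⋖_ L (Lattice._∧_ L x y) y →
    ¬ (_⋖_ L x (Lattice._∨_ L x y)) →
    (ay : Lattice.Carrier L) → IsAtom L bot ay →
    Lattice._≈_ L y (Lattice._∨_ L (Lattice._∧_ L x y) ay) →
    (z : Lattice.Carrier L) → _⋖_ L x z → ¬ (_∈A_ L bot ay z)
lemma3 L _ _ _ _ _ _ _ (x∧y<y , _) ¬x⋖x∨y _ _ y≈x∧y∨ay _ x⋖z@((x≤z , _) , _) (_ , ay≤z) =
  ⋖-below-cover L x⋖z (<L-∨ʳ L x∧y<y) (∨-least-via-meet L y≈x∧y∨ay x≤z ay≤z) ¬x⋖x∨y
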